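{- Let $k,d$ be positive integers and let $G$ be a graph. If $\omega(G)\le k$ and $\chi(G)>kd$, then $G$ has a path $P$ of length $1$ such that $\Omega(G,P)$ has a component $C$ attached to $P$ with $\chi(C)>d$.
   Context: A path from $v$ to $w$ is a sequence $v_0v_1\cdots v_\ell$ of distinct vertices with $v_0=v$, $v_\ell=w$ and $v_i$ adjacent to $v_{i-1}$ for all $i$; its length is $\ell$ and $w$ is its last vertex. For a set $X$ of vertices, $N_G(X)=(\bigcup_{x\in X}N_G(x))\setminus X$. For an induced path $P$ from $v$ to $w$ in $G$, $\Omega(G,P)$ denotes the graph $G\setminus(V(P)\cup N_G(V(P)\setminus\{w\}))$. A component of $\Omega(G,P)$ is attached to $P$ if it contains a neighbor of $w$. -}

module Defs where

open import Data.Nat using (ℕ; suc)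
open import Data.Fin using (Fin)
open import Data.Product using (Σ; _×_)
open import Data.Unit using (⊤)
open import Relation.Nullary using (¬_; Dec)
open import Relation.Binary.PropositionalEquality using (_≡_; _≢_)
open import Function.Definitions using (Injective)

record Graph (n : ℕ) : Set₁ where
  field
    Adj    : Fin n → Fin n → Set
    adj?   : ∀ x y → Dec (Adj x y)
    sym    : ∀ {x y} → Adj x y → Adj y x
    irrefl : ∀ {x} → ¬ Adj x x
open Graph public

module _ {n : ℕ} (G : Graph n) where

  Colorable : (S : Fin n → Set) → ℕ → Set
  Colorable S m =
    Σ (Σ (Fin n) S → Fin m) λ c →
      ∀ (x y : Σ (Fin n) S) → Adj G (Data.Product.proj₁ x) (Data.Product.proj₁ y) → c x ≢ c y

  ChromaticGreater : (S : Fin n → Set) → ℕ → Set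
  ChromaticGreater S m = ¬ Colorable S m

  Clique : ℕ → Set
  Clique m = Σ (Fin m → Fin n) λ f →
    Injective _≡_ _≡_ f × (∀ i j → i ≢ j → Adj G (f i) (f j))

  CliqueNumberAtMost : ℕ → Set
  CliqueNumberAtMost k = ¬ Clique (suc k)

  -- vertex set of Ω(G,P) for the path P = v w (length 1):
  -- remove v, w and N_G(v)
  Ω₁ : Fin n → Fin n → Fin n → Set
  Ω₁ v w u = (u ≢ v) × (u ≢ w) × ¬ Adj G v u

  -- y is reachable from x by a path inside S (connected component of G[S] containing x)
  data Reach (S : Fin n → Set) (x : Fin n) : Fin n → Set where
    here : S x → Reach S x x
    step : ∀ {y z} → Reach S x y → Adj G y z → S z → Reach S x z

module Submission where

-- Proof by induction on k, relative to an induced subgraph G[U].  For k = 0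
-- the hypotheses are contradictory.  For k + 1, first pass to a component C of
-- G[U] with χ(C) > (k+1)d and pick v ∈ C.  Split C into v, its neighbours
-- ("near") and the rest ("far").  If χ(near) > k·d we recurse, since near has
-- no (k+1)-clique.  Otherwise, if every component of Ω(C, vw) attached to an
-- edge vw had χ ≤ d, then C would be (d + k·d)-colourable: the near part gets
-- k·d private colours, and each component of the far part, which is attached
-- because C is connected, is coloured with d colours shared with v.

open import Defs
open import Data.Nat using (ℕ; zero; suc; _+_; _*_; _≤′_; ≤′-refl; ≤′-step; NonZero)
open import Data.Nat.Properties using (n<1+n; z≤′n; ≤⇒≤′)
open import Data.Fin using (Fin; zero; suc; toℕ; join; splitAt; _<_)
open import Data.Fin.Properties using (any?; all?; ¬∀⟶∃¬; pigeonhole; splitAt-join; ¬Fin0; _≟_)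
open import Data.Maybe using (Maybe; just; nothing)
import Data.Maybe as Maybe
open import Data.Product using (Σ; ∃; _×_; _,_; proj₁; proj₂)
open import Data.Sum using (_⊎_; inj₁; inj₂)
open import Data.Sum.Properties using (inj₁-injective; inj₂-injective)
open import Data.Unit using (⊤; tt)
open import Data.Empty using (⊥-elim)
open import Data.Vec using (Vec; []; _∷_; lookup; tabulate)
open import Data.Vec.Properties using (lookup∘tabulate)
import Data.Vec.Functional as Vector
open import Function.Definitions using (Injective)
open import Relation.Nullary using (¬_; Dec; yes; no; contradiction)
open import Relation.Nullary.Decidable
  using (_×-dec_; _⊎-dec_; _→-dec_; ¬?; map′; recompute; decidable-stable)
open import Relation.Unary using (Decidable)
open import Relation.Binary.PropositionalEquality
  using (_≡_; _≢_; refl; cong; subst; module ≡-Reasoning)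
  renaming (sym to ≡-sym)

∃-vec? : ∀ {m} a {P : Vec (Fin m) a → Set} → Decidable P → Dec (∃ P)
∃-vec? zero P? with P? []
... | yes p = yes ([] , p)
... | no ¬p = no λ { ([] , p) → ¬p p }
∃-vec? (suc a) P? with any? (λ x → ∃-vec? a (λ xs → P? (x ∷ xs)))
... | yes (x , xs , p) = yes (x ∷ xs , p)
... | no ¬p = no λ { (x ∷ xs , p) → ¬p (x , xs , p) }

-- Unlike the
-- witness of any?, it depends only on which indices satisfy the predicate
-- (first-cong), which makes it usable as a canonical choice.
first : ∀ {m} {P : Fin m → Set} → Decidable P → Maybe (Fin m)
first {zero} P? = nothing
first {suc m} P? = first-from (P? zero) (first (λ i → P? (suc i)))
  where
    first-from : ∀ {A : Set} → Dec A → Maybe (Fin m) → Maybe (Fin (suc m))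
    first-from (yes _) _ = just zero
    first-from (no _) rest = Maybe.map suc rest

first-just : ∀ {m} {P : Fin m → Set} (P? : Decidable P) {i} → first P? ≡ just i → P i
first-just {suc m} P? e with P? zero | first (λ i → P? (suc i)) in e′
first-just {suc m} P? refl | yes p | _ = p
first-just {suc m} P? refl | no _ | just j = first-just (λ i → P? (suc i)) e′

first-nothing : ∀ {m} {P : Fin m → Set} (P? : Decidable P) → first P? ≡ nothing → ∀ i → ¬ P i
first-nothing {suc m} P? e i p with P? zero | first (λ i → P? (suc i)) in e′
first-nothing {suc m} P? refl zero p | no ¬p | nothing = ¬p p
first-nothing {suc m} P? refl (suc i) p | no _ | nothing = first-nothing (λ i → P? (suc i)) e′ i p

first-cong : ∀ {m} {P Q : Fin m → Set} (P? : Decidable P) (Q? : Decidable Q) →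
  (∀ i → P i → Q i) → (∀ i → Q i → P i) → first P? ≡ first Q?
first-cong {zero} P? Q? P⇒Q Q⇒P = refl
first-cong {suc m} P? Q? P⇒Q Q⇒P with P? zero | Q? zero
... | yes _ | yes _ = refl
... | yes p | no ¬q = contradiction (P⇒Q zero p) ¬q
... | no ¬p | yes q = contradiction (Q⇒P zero q) ¬p
... | no _ | no _ = cong (Maybe.map suc)
  (first-cong (λ i → P? (suc i)) (λ i → Q? (suc i)) (λ i → P⇒Q (suc i)) (λ i → Q⇒P (suc i)))

join-injective : ∀ a b {i j : Fin a ⊎ Fin b} → join a b i ≡ join a b j → i ≡ j
join-injective a b {i} {j} e = begin
  i                        ≡⟨ splitAt-join a b i ⟨
  splitAt a (join a b i)   ≡⟨ cong (splitAt a) e ⟩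
  splitAt a (join a b j)   ≡⟨ splitAt-join a b j ⟩
  j                        ∎
  where open ≡-Reasoning

module _ {n : ℕ} (G : Graph n) where

  reach-in : ∀ {S x y} → Reach G S x y → S y
  reach-in (here s) = s
  reach-in (step _ _ s) = s

  reach-mono : ∀ {S T : Fin n → Set} {x y} → (∀ z → S z → T z) → Reach G S x y → Reach G T x y
  reach-mono S⊆T (here s) = here (S⊆T _ s)
  reach-mono S⊆T (step r adj s) = step (reach-mono S⊆T r) adj (S⊆T _ s)

  component-connected : ∀ {S x y} → Reach G S x y → Reach G (Reach G S x) x y
  component-connected (here s) = here (here s)
  component-connected (step r adj s) = step (component-connected r) adj (step r adj s)

  -- Reachability inside a decidable set S is decidable: the sets of vertices
  -- reached by walks of at most l steps grow with l, and must stop growing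
  -- within n steps since every growing step adds a new vertex.
  module Reachability {S : Fin n → Set} (S? : Decidable S) (x : Fin n) where

    Within : ℕ → Fin n → Set
    Within zero y = S y × x ≡ y
    Within (suc l) y = Within l y ⊎ ∃ λ z → Within l z × Adj G z y × S y

    within? : ∀ l → Decidable (Within l)
    within? zero y = S? y ×-dec (x ≟ y)
    within? (suc l) y = within? l y ⊎-dec any? (λ z → within? l z ×-dec (adj? G z y ×-dec S? y))

    within-sound : ∀ l {y} → Within l y → Reach G S x y
    within-sound zero (s , refl) = here s
    within-sound (suc l) (inj₁ w) = within-sound l w
    within-sound (suc l) (inj₂ (_ , w , adj , s)) = step (within-sound l w) adj s

    within-complete : ∀ {y} → Reach G S x y → ∃ λ l → Within l y
    within-complete (here s) = zero , s , refl
    within-complete (step r adj s) with within-complete r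
    ... | l , w = suc l , inj₂ (_ , w , adj , s)

    within-mono : ∀ {l L} → l ≤′ L → ∀ {y} → Within l y → Within L y
    within-mono ≤′-refl w = w
    within-mono (≤′-step l≤L) w = inj₁ (within-mono l≤L w)

    Saturated : ℕ → Set
    Saturated l = ∀ y → Within (suc l) y → Within l y

    saturated? : ∀ l → Dec (Saturated l)
    saturated? l = all? λ y → within? (suc l) y →-dec within? l y

    saturated-max : ∀ {s} → Saturated s → ∀ l {y} → Within l y → Within s y
    saturated-max sat zero w = within-mono z≤′n w
    saturated-max sat (suc l) (inj₁ w) = saturated-max sat l w
    saturated-max sat (suc l) (inj₂ (z , w , adj , s)) = sat _ (inj₂ (z , saturated-max sat l w , adj , s))

    fresh : ∀ l → ¬ Saturated l → ∃ λ y → Within (suc l) y × ¬ Within l y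
    fresh l unsat with ¬∀⟶∃¬ n _ (λ y → within? (suc l) y →-dec within? l y) unsat
    ... | y , ¬grows = y , decidable-stable (within? (suc l) y) (λ ¬w → ¬grows λ w → contradiction w ¬w)
                         , λ w → ¬grows λ _ → w

    -- Among the levels 0..n some is saturated: otherwise the fresh vertices
    -- of these n + 1 levels would be n + 1 distinct vertices.
    saturation : ∃ Saturated
    saturation with any? (λ (l : Fin (suc n)) → saturated? (toℕ l))
    ... | yes (l , sat) = toℕ l , sat
    ... | no none = ⊥-elim (fresh-distinct (pigeonhole (n<1+n n) new))
      where
        new-vertex : ∀ l → ∃ λ y → Within (suc (toℕ l)) y × ¬ Within (toℕ l) y
        new-vertex l = fresh (toℕ l) (λ sat → none (l , sat))
        new : Fin (suc n) → Fin n
        new l = proj₁ (new-vertex l)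
        fresh-distinct : ¬ ∃ λ i → ∃ λ j → i < j × new i ≡ new j
        fresh-distinct (i , j , i<j , same) = proj₂ (proj₂ (new-vertex j))
          (subst (Within (toℕ j)) same (within-mono (≤⇒≤′ i<j) (proj₁ (proj₂ (new-vertex i)))))

    decide : Decidable (Reach G S x)
    decide y = map′ (within-sound s) (λ r → saturated-max sat _ (proj₂ (within-complete r))) (within? s y)
      where
        s : ℕ
        s = proj₁ saturation
        sat : Saturated s
        sat = proj₂ saturation

  reach? : ∀ {S} → Decidable S → ∀ x → Decidable (Reach G S x)
  reach? S? x = Reachability.decide S? x

  colourable-mono : ∀ {S T : Fin n → Set} {m} → (∀ z → T z → S z) → Colorable G S m → Colorable G T m
  colourable-mono T⊆S (c , proper) =
    (λ { (z , t) → c (z , T⊆S z t) }) , λ { (y , _) (z , _) adj → proper _ _ adj }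

  empty-colourable : ∀ {S : Fin n → Set} {m} → (∀ z → ¬ S z) → Colorable G S m
  empty-colourable empty = (λ { (z , s) → contradiction s (empty z) }) , λ { (z , s) → contradiction s (empty z) }

  ProperOn : (Fin n → Set) → ∀ {m} → (Fin n → Fin m) → Set
  ProperOn S c = ∀ x y → S x → S y → Adj G x y → c x ≢ c y

  properOn? : ∀ {S} → Decidable S → ∀ {m} (c : Fin n → Fin m) → Dec (ProperOn S c)
  properOn? S? c = all? λ x → all? λ y → S? x →-dec (S? y →-dec (adj? G x y →-dec ¬? (c x ≟ c y)))

  -- Colourability of a decidable induced subgraph is decidable: with at least
  -- one colour, every colouring extends to a total one, and total colourings
  -- are finitely many (as vectors of colours).
  colourable? : ∀ {S} → Decidable S → ∀ m → Dec (Colorable G S m)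
  colourable? S? zero with any? S?
  ... | yes (x , s) = no λ { (c , _) → ¬Fin0 (c (x , s)) }
  ... | no ¬s = yes (empty-colourable λ z s → ¬s (z , s))
  colourable? {S} S? (suc m) with ∃-vec? n (λ cs → properOn? S? (lookup cs))
  ... | yes (cs , p) = yes ((λ { (x , _) → lookup cs x }) , λ { (x , sx) (y , sy) → p x y sx sy })
  ... | no ¬p = no λ col → ¬p (tabulate (extend col) , tabulated-proper col)
    where
      extend : Colorable G S (suc m) → Fin n → Fin (suc m)
      extend (c , _) x with S? x
      ... | yes s = c (x , s)
      ... | no _ = zero
      extend-proper : (col : Colorable G S (suc m)) → ProperOn S (extend col)
      extend-proper (c , p) x y sx sy adj with S? x | S? y
      ... | yes s | yes s′ = p (x , s) (y , s′) adj
      ... | no ¬s | _ = contradiction sx ¬s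
      ... | yes _ | no ¬s = contradiction sy ¬s
      tabulated-proper : (col : Colorable G S (suc m)) → ProperOn S (lookup (tabulate (extend col)))
      tabulated-proper col x y sx sy adj e = extend-proper col x y sx sy adj (begin
        extend col x                     ≡⟨ lookup∘tabulate (extend col) x ⟨
        lookup (tabulate (extend col)) x ≡⟨ e ⟩
        lookup (tabulate (extend col)) y ≡⟨ lookup∘tabulate (extend col) y ⟩
        extend col y                     ∎)
        where open ≡-Reasoning

  colour-split : ∀ {S P : Fin n → Set} → Decidable P → ∀ {a b} →
    Colorable G (λ z → S z × ¬ P z) a → Colorable G (λ z → S z × P z) b → Colorable G S (a + b)
  colour-split {S} {P} P? {a} {b} (c₁ , p₁) (c₂ , p₂) = colour , proper
    where
      side : ∀ z → S z → Dec (P z) → Fin a ⊎ Fin b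
      side z s (no ¬p) = inj₁ (c₁ (z , s , ¬p))
      side z s (yes p) = inj₂ (c₂ (z , s , p))
      side-proper : ∀ {z z′} s s′ (dz : Dec (P z)) (dz′ : Dec (P z′)) → Adj G z z′ →
        side z s dz ≢ side z′ s′ dz′
      side-proper s s′ (no _) (no _) adj e = p₁ _ _ adj (inj₁-injective e)
      side-proper s s′ (yes _) (yes _) adj e = p₂ _ _ adj (inj₂-injective e)
      colour : Σ (Fin n) S → Fin (a + b)
      colour (z , s) = join a b (side z s (P? z))
      proper : ∀ (y z : Σ (Fin n) S) → Adj G (proj₁ y) (proj₁ z) → colour y ≢ colour z
      proper (y , s) (z , s′) adj e = side-proper s s′ (P? y) (P? z) adj (join-injective a b e)

  colour-add-isolated : ∀ {S T : Fin n → Set} v → (∀ z → S z → ¬ Adj G v z) →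
    (∀ z → S z → z ≢ v → T z) → ∀ {m} → Colorable G T (suc m) → Colorable G S (suc m)
  colour-add-isolated {S} v isolated rest {m} (c , p) = colour , proper
    where
      pick : ∀ z → S z → Dec (z ≡ v) → Fin (suc m)
      pick z s (yes _) = zero
      pick z s (no z≢v) = c (z , rest z s z≢v)
      pick-proper : ∀ {z z′} s s′ (dz : Dec (z ≡ v)) (dz′ : Dec (z′ ≡ v)) → Adj G z z′ →
        pick z s dz ≢ pick z′ s′ dz′
      pick-proper s s′ (yes refl) (yes refl) adj _ = irrefl G adj
      pick-proper s s′ (yes refl) (no _) adj _ = isolated _ s′ adj
      pick-proper s s′ (no _) (yes refl) adj _ = isolated _ s (sym G adj)
      pick-proper s s′ (no _) (no _) adj e = p _ _ adj e
      colour : Σ (Fin n) S → Fin (suc m)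
      colour (z , s) = pick z s (z ≟ v)
      proper : ∀ (y z : Σ (Fin n) S) → Adj G (proj₁ y) (proj₁ z) → colour y ≢ colour z
      proper (y , s) (z , s′) adj = pick-proper s s′ (y ≟ v) (z ≟ v) adj

  -- If every vertex of S lies in the component (inside S) of a representative,
  -- and each representative's component is m-colourable, then so is G[S]:
  -- colour every vertex as in the component of its first representative.
  -- Adjacent vertices have the same representatives, hence the same first one.
  colour-by-components : ∀ {S R : Fin n → Set} {m} → Decidable R → (∀ x → Decidable (Reach G S x)) →
    (∀ y → S y → ∃ λ x → R x × Reach G S x y) →
    (∀ x → R x → Colorable G (Reach G S x) m) → Colorable G S m
  colour-by-components {S} {R} {m} R? reach-from? cover colour-of = colour , proper
    where
      Rep : Fin n → Fin n → Set
      Rep y x = R x × Reach G S x y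
      rep? : ∀ y → Decidable (Rep y)
      rep? y x = R? x ×-dec reach-from? x y
      -- the proof of R x is recomputed, so the colouring used depends on x only
      paint : ∀ x {y} → Rep y x → Fin m
      paint x {y} (r , p) = proj₁ (colour-of x (recompute (R? x) r)) (y , p)
      unrepresented : ∀ {y} → S y → first (rep? y) ≢ nothing
      unrepresented {y} s e = let (x , q) = cover y s in first-nothing (rep? y) e x q
      colourWith : ∀ y → S y → (mx : Maybe (Fin n)) → first (rep? y) ≡ mx → Fin m
      colourWith y s (just x) e = paint x (first-just (rep? y) e)
      colourWith y s nothing e = contradiction e (unrepresented s)
      colourWith-proper : ∀ {y y′} s s′ {mx mx′} → mx ≡ mx′ →
        (e : first (rep? y) ≡ mx) (e′ : first (rep? y′) ≡ mx′) → Adj G y y′ →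
        colourWith y s mx e ≢ colourWith y′ s′ mx′ e′
      colourWith-proper s s′ {just x} refl e e′ adj = proj₂ (colour-of x _) _ _ adj
      colourWith-proper s s′ {nothing} refl e e′ adj = contradiction e (unrepresented s)
      colour : Σ (Fin n) S → Fin m
      colour (y , s) = colourWith y s (first (rep? y)) refl
      proper : ∀ (y z : Σ (Fin n) S) → Adj G (proj₁ y) (proj₁ z) → colour y ≢ colour z
      proper (y , s) (z , s′) adj = colourWith-proper s s′ same-first refl refl adj
        where
          same-first : first (rep? y) ≡ first (rep? z)
          same-first = first-cong (rep? y) (rep? z)
            (λ { x (r , p) → r , step p adj s′ }) (λ { x (r , p) → r , step p (sym G adj) s })

  uncolourable-component : ∀ {S m} → Decidable S → ¬ Colorable G S m →
    ∃ λ v → S v × ¬ Colorable G (Reach G S v) m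
  uncolourable-component {S} {m} S? uncol with any? (λ v → S? v ×-dec ¬? (colourable? (reach? S? v) m))
  ... | yes found = found
  ... | no none = contradiction (colour-by-components S? (reach? S?) (λ y s → y , s , here s) colourable) uncol
    where
      colourable : ∀ v → S v → Colorable G (Reach G S v) m
      colourable v s = decidable-stable (colourable? (reach? S? v) m) λ u → none (v , s , u)

  CliqueIn : (Fin n → Set) → ℕ → Set
  CliqueIn U m = Σ (Fin m → Fin n) λ f →
    Injective _≡_ _≡_ f × (∀ i → U (f i)) × (∀ i j → i ≢ j → Adj G (f i) (f j))

  clique-mono : ∀ {U V : Fin n → Set} {m} → (∀ z → U z → V z) → CliqueIn U m → CliqueIn V m
  clique-mono U⊆V (f , inj , inU , adj) = f , inj , (λ i → U⊆V _ (inU i)) , adj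

  clique-cone : ∀ {U : Fin n → Set} {m} {v} → U v → CliqueIn (λ z → U z × Adj G v z) m → CliqueIn U (suc m)
  clique-cone {U} {m} {v} uv (f , inj , inN , adj) = (v Vector.∷ f) , inj′ , inU′ , adj′
    where
      inj′ : Injective _≡_ _≡_ (v Vector.∷ f)
      inj′ {zero} {zero} e = refl
      inj′ {zero} {suc j} e = contradiction (subst (Adj G v) (≡-sym e) (proj₂ (inN j))) (irrefl G)
      inj′ {suc i} {zero} e = contradiction (subst (Adj G v) e (proj₂ (inN i))) (irrefl G)
      inj′ {suc i} {suc j} e = cong suc (inj e)
      inU′ : ∀ i → U ((v Vector.∷ f) i)
      inU′ zero = uv
      inU′ (suc i) = proj₁ (inN i)
      adj′ : ∀ i j → i ≢ j → Adj G ((v Vector.∷ f) i) ((v Vector.∷ f) j)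
      adj′ zero zero i≢j = contradiction refl i≢j
      adj′ zero (suc j) _ = proj₂ (inN j)
      adj′ (suc i) zero _ = sym G (proj₂ (inN i))
      adj′ (suc i) (suc j) i≢j = adj i j (λ e → i≢j (cong suc e))

  no-1-clique : ∀ {U : Fin n → Set} → ¬ CliqueIn U 1 → ∀ z → ¬ U z
  no-1-clique noClique z u = noClique ((λ _ → z) , (λ { {zero} {zero} _ → refl }) , (λ _ → u) ,
    λ { zero zero 0≢0 → contradiction refl 0≢0 })

  Ω₁? : ∀ v w → Decidable (Ω₁ G v w)
  Ω₁? v w u = ¬? (u ≟ v) ×-dec (¬? (u ≟ w) ×-dec ¬? (adj? G v u))

  module _ (d′ : ℕ) where

    -- The conclusion of Lemma 4.1 (with d = suc d′) inside G[U]: an edge vw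
    -- and a vertex x, adjacent to w, whose component in Ω(G[U], vw) has χ > d.
    Witness : (Fin n → Set) → Set
    Witness U = Σ (Fin n) λ v → Σ (Fin n) λ w → Adj G v w ×
      Σ (Fin n) λ x → Ω₁ G v w x × Adj G w x ×
        ChromaticGreater G (Reach G (λ u → Ω₁ G v w u × U u) x) (suc d′)

    witness-mono : ∀ {U V : Fin n → Set} → (∀ z → U z → V z) → Witness U → Witness V
    witness-mono U⊆V (v , w , vw , x , ωx , wx , uncol) = v , w , vw , x , ωx , wx ,
      λ col → uncol (colourable-mono (λ _ → reach-mono λ u (ωu , uu) → ωu , U⊆V u uu) col)

    module Around {C : Fin n → Set} (C? : Decidable C) (v : Fin n)
        (connected : ∀ y → C y → Reach G C v y) where

      Near : Fin n → Set
      Near z = C z × Adj G v z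

      Far : Fin n → Set
      Far z = C z × z ≢ v × ¬ Adj G v z

      Attached : Fin n → Set
      Attached x = Far x × ∃ λ w → Near w × Adj G w x

      near? : Decidable Near
      near? z = C? z ×-dec adj? G v z

      far? : Decidable Far
      far? z = C? z ×-dec (¬? (z ≟ v) ×-dec ¬? (adj? G v z))

      attached? : Decidable Attached
      attached? x = far? x ×-dec any? (λ w → near? w ×-dec adj? G w x)

      trichotomy : ∀ {z} → C z → z ≡ v ⊎ Near z ⊎ Far z
      trichotomy {z} cz with z ≟ v | adj? G v z
      ... | yes z≡v | _ = inj₁ z≡v
      ... | no _ | yes vz = inj₂ (inj₁ (cz , vz))
      ... | no z≢v | no ¬vz = inj₂ (inj₂ (cz , z≢v , ¬vz))

      -- Every far vertex lies in the far component of an attached vertex: walk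
      -- back along a path from v; the last near vertex before the far part
      -- makes the next vertex attached.
      far-cover : ∀ y → Far y → ∃ λ x → Attached x × Reach G Far x y
      far-cover y fy = from-path (connected y (proj₁ fy)) fy
        where
          from-path : ∀ {y} → Reach G C v y → Far y → ∃ λ x → Attached x × Reach G Far x y
          from-path (here _) (_ , v≢v , _) = contradiction refl v≢v
          from-path {y} (step r adj _) fy with trichotomy (reach-in r)
          ... | inj₁ refl = contradiction adj (proj₂ (proj₂ fy))
          ... | inj₂ (inj₁ nz) = y , (fy , _ , nz , adj) , here fy
          ... | inj₂ (inj₂ fz) with from-path r fz
          ...   | x , att , p = x , att , step p adj fy

      far⊆Ω : ∀ {w z} → Near w → Far z → Ω₁ G v w z × C z
      far⊆Ω (_ , vw) (cz , z≢v , ¬vz) = (z≢v , (λ z≡w → ¬vz (subst (Adj G v) (≡-sym z≡w) vw)) , ¬vz) , cz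

      colour-around : ∀ {m} → Colorable G Near m →
        (∀ w x → Near w → Far x → Adj G w x →
          Colorable G (Reach G (λ u → Ω₁ G v w u × C u) x) (suc d′)) →
        Colorable G C (suc d′ + m)
      colour-around colNear colAttached = colour-split (adj? G v) colRest colNear
        where
          colFar : Colorable G Far (suc d′)
          colFar = colour-by-components attached? (reach? far?) far-cover
            λ { x (fx , w , nw , wx) → colourable-mono (λ _ → reach-mono λ _ → far⊆Ω nw)
                                         (colAttached w x nw fx wx) }
          colRest : Colorable G (λ z → C z × ¬ Adj G v z) (suc d′)
          colRest = colour-add-isolated v (λ _ → proj₂) (λ { z (cz , ¬vz) z≢v → cz , z≢v , ¬vz }) colFar

      bad-component : ∀ {m} → Colorable G Near m → ¬ Colorable G C (suc d′ + m) → Witness C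
      bad-component colNear uncolC with any? (λ w → any? λ x →
          (near? w ×-dec (far? x ×-dec adj? G w x)) ×-dec
          ¬? (colourable? (reach? (λ u → Ω₁? v w u ×-dec C? u) x) (suc d′)))
      ... | yes (w , x , (nw , fx , wx) , uncol) = v , w , proj₂ nw , x , proj₁ (far⊆Ω nw fx) , wx , uncol
      ... | no none = contradiction (colour-around colNear colAttached) uncolC
        where
          colAttached : ∀ w x → Near w → Far x → Adj G w x →
            Colorable G (Reach G (λ u → Ω₁ G v w u × C u) x) (suc d′)
          colAttached w x nw fx wx = decidable-stable (colourable? (reach? (λ u → Ω₁? v w u ×-dec C? u) x) (suc d′))
            λ uncol → none (w , x , (nw , fx , wx) , uncol)

    witness : ∀ k {U} → Decidable U → ¬ CliqueIn U (suc k) → ¬ Colorable G U (k * suc d′) → Witness U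
    witness zero U? noClique uncol = contradiction (empty-colourable (no-1-clique noClique)) uncol
    witness (suc k) {U} U? noClique uncol with uncolourable-component U? uncol
    ... | v , uv , uncolC = witness-mono C⊆U inComponent
      where
        C⊆U : ∀ z → Reach G U v z → U z
        C⊆U _ = reach-in
        open Around (reach? U? v) v (λ _ → component-connected)
        noCliqueNear : ¬ CliqueIn Near (suc k)
        noCliqueNear q = noClique (clique-mono C⊆U (clique-cone {U = Reach G U v} (here uv) q))
        inComponent : Witness (Reach G U v)
        inComponent with colourable? near? (k * suc d′)
        ... | yes colNear = bad-component colNear uncolC
        ... | no uncolNear = witness-mono (λ _ → proj₁) (witness k near? noCliqueNear uncolNear)

lemma4p1 : (k d : ℕ) → .{{_ : NonZero k}} → .{{_ : NonZero d}} →
    (n : ℕ) → (G : Graph n) →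
    CliqueNumberAtMost G k → ChromaticGreater G (λ _ → ⊤) (k * d) →
    Σ (Fin n) λ v → Σ (Fin n) λ w → Adj G v w ×
      Σ (Fin n) λ x → Ω₁ G v w x × Adj G w x ×
        ChromaticGreater G (Reach G (Ω₁ G v w) x) d
lemma4p1 k (suc d′) n G noClique uncol =
  let v , w , vw , x , ωx , wx , uncolΩ = witness G d′ k (λ _ → yes tt) noClique′ uncol
  in v , w , vw , x , ωx , wx , λ col → uncolΩ (colourable-mono G (λ _ → reach-mono G λ _ → proj₁) col)
  where
    noClique′ : ¬ CliqueIn G (λ _ → ⊤) (suc k)
    noClique′ (f , inj , _ , adj) = noClique (f , inj , adj)
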